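{- Let $W\subseteq\mathbb{N}$ and let $C'$ be an $[n',k',W]_q$ code with generator matrix $G'$ whose minimum column multiplicity is $r$. Then there exists a systematic generator matrix $G$ of an $[n'-r,k'-1,W]_q$ code $C$ with minimum column multiplicity at least $r$ such that the extension of $G$ with parameter $r$ contains at least one code isomorphic to $C'$.
   Context: An $[n,k]_q$ code is a $k$-dimensional subspace of $\mathbb{F}_q^n$ whose effective length equals $n$ (every coordinate is non-zero in some codeword); it is an $[n,k,W]_q$ code if every non-zero codeword has Hamming weight in $W$. A systematic generator matrix has the form $(I_k\,|\,R)$. The multiplicity of a column $g$ of a generator matrix is the number of columns whose span equals $\langle g\rangle$; the minimum (maximum) column multiplicity is the minimum (maximum) of these over all columns. For a systematic generator matrix $G$ of an $[n,k]_q$ code and an integer $r\ge1$, the extension of $G$ with parameter $r$ is the set of $[n+r,k+1]_q$ codes (with weights in $W$) having a systematic generator matrix whose first $k$ rows equal $G$ with $r$ additional all-zero columns inserted. Two codes are isomorphic if they are linearly isometric (equivalent under coordinate permutations, scalings of coordinates and field automorphisms). -}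

module Defs where

open import Level using (0ℓ)
open import Data.Nat using (ℕ; zero; suc; _<_; _≤_)
import Data.Nat as ℕ
open import Data.Fin using (Fin; toℕ)
open import Data.Product using (Σ; ∃; ∃-syntax; _×_; _,_)
open import Data.Sum using (_⊎_)
open import Relation.Nullary using (¬_; Dec; yes; no)
open import Relation.Binary.PropositionalEquality using (_≡_; _≢_)
open import Algebra.Structures using (IsCommutativeRing)
open import Function.Bundles using (_↔_)
open import Function.Definitions using (Injective)
open import Function.Bundles using (Inverse)
import Data.Fin as Fin

record FiniteField : Set₁ where
  infixl 7 _*_
  infixl 6 _+_
  field
    Carrier : Set
    _+_ _*_ : Carrier → Carrier → Carrier
    -_      : Carrier → Carrier
    0# 1#   : Carrier
    isCommutativeRing : IsCommutativeRing _≡_ _+_ _*_ -_ 0# 1#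
    0≢1     : 0# ≢ 1#
    inverse : ∀ x → x ≢ 0# → ∃[ y ] (x * y ≡ 1#)
    _≟_     : (x y : Carrier) → Dec (x ≡ y)
    size    : ℕ
    finite  : Carrier ↔ Fin size

module _ (F : FiniteField) where
  open FiniteField F

  Vector : ℕ → Set
  Vector n = Fin n → Carrier

  Matrix : ℕ → ℕ → Set
  Matrix k n = Fin k → Fin n → Carrier

  Σ[<_]_ : (n : ℕ) → (Fin n → Carrier) → Carrier
  Σ[< zero ] f = 0#
  Σ[< suc n ] f = f Fin.zero + Σ[< n ] (λ i → f (Fin.suc i))

  encode : ∀ {k n} → Matrix k n → Vector k → Vector n
  encode G x j = Σ[< _ ] (λ i → x i * G i j)

  InCode : ∀ {k n} → Matrix k n → Vector n → Set
  InCode G v = ∃[ x ] (∀ j → encode G x j ≡ v j)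

  IsZero : ∀ {n} → Vector n → Set
  IsZero v = ∀ j → v j ≡ 0#

  wt : ∀ {n} → Vector n → ℕ
  wt {zero} v = 0
  wt {suc n} v with v Fin.zero ≟ 0#
  ... | yes _ = wt (λ i → v (Fin.suc i))
  ... | no _  = suc (wt (λ i → v (Fin.suc i)))

  column : ∀ {k n} → Matrix k n → Fin n → Vector k
  column G j i = G i j

  FullRank : ∀ {k n} → Matrix k n → Set
  FullRank G = ∀ x → IsZero (encode G x) → IsZero x

  EffectiveLength : ∀ {k n} → Matrix k n → Set
  EffectiveLength G = ∀ j → ∃[ v ] (InCode G v × v j ≢ 0#)

  WeightsIn : ∀ {k n} → (ℕ → Set) → Matrix k n → Set
  WeightsIn W G = ∀ v → InCode G v → ¬ IsZero v → W (wt v)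

  GeneratesCode : ∀ k n → (ℕ → Set) → Matrix k n → Set
  GeneratesCode k n W G = FullRank G × EffectiveLength G × WeightsIn W G

  InSpan : ∀ {k} → Vector k → Vector k → Set
  InSpan g v = ∃[ a ] (∀ i → v i ≡ a * g i)

  SameSpan : ∀ {k} → Vector k → Vector k → Set
  SameSpan g h = ∀ v → (InSpan g v → InSpan h v) × (InSpan h v → InSpan g v)

  Multiplicity : ∀ {k n} → Matrix k n → Fin n → ℕ → Set
  Multiplicity {n = n} G j m =
    Σ (Fin m → Fin n) λ e →
      Injective _≡_ _≡_ e ×
      (∀ a → SameSpan (column G (e a)) (column G j)) ×
      (∀ i → SameSpan (column G i) (column G j) → ∃[ a ] (e a ≡ i))

  MinMultAtLeast : ∀ {k n} → Matrix k n → ℕ → Set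
  MinMultAtLeast G r = ∀ j → ∃[ m ] (Multiplicity G j m × r ≤ m)

  MinMult : ∀ {k n} → Matrix k n → ℕ → Set
  MinMult {n = n} G r = MinMultAtLeast G r × ∃[ j ] Multiplicity G j r

  Systematic : ∀ {k n} → Matrix k n → Set
  Systematic {k} {n} G =
    k ≤ n ×
    (∀ (i : Fin k) (j : Fin n) → toℕ j < k →
        (toℕ i ≡ toℕ j → G i j ≡ 1#) × (toℕ i ≢ toℕ j → G i j ≡ 0#))

  -- linear isometry (semilinear monomial map) between codes:
  -- v ↦ (λ_j · τ(v_{σ j}))_j , with σ a bijection of coordinates,
  -- λ_j non-zero, τ a field automorphism
  Isomorphic : ∀ {k₁ n₁ k₂ n₂} → Matrix k₁ n₁ → Matrix k₂ n₂ → Set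
  Isomorphic {n₁ = n₁} {n₂ = n₂} G₁ G₂ =
    Σ (Fin n₂ ↔ Fin n₁) λ σ →
    Σ (Fin n₂ → Carrier) λ λs →
    Σ (Carrier ↔ Carrier) λ τ →
      (∀ j → λs j ≢ 0#) ×
      (∀ x y → Inverse.to τ (x + y) ≡ Inverse.to τ x + Inverse.to τ y) ×
      (∀ x y → Inverse.to τ (x * y) ≡ Inverse.to τ x * Inverse.to τ y) ×
      (∀ (v : Vector n₁) →
         (InCode G₁ v → InCode G₂ (λ j → λs j * Inverse.to τ (v (Inverse.to σ j)))) ×
         (InCode G₂ (λ j → λs j * Inverse.to τ (v (Inverse.to σ j))) → InCode G₁ v))

  FirstRowsInserted : ∀ {k n} r → Matrix k n → Matrix (suc k) (n ℕ.+ r) → Set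
  FirstRowsInserted {k} {n} r G G' =
    Σ (Fin n → Fin (n ℕ.+ r)) λ ι →
      (∀ a b → a Fin.< b → ι a Fin.< ι b) ×
      (∀ (i : Fin k) (j : Fin n) → G' (Fin.inject₁ i) (ι j) ≡ G i j) ×
      (∀ (i : Fin k) (l : Fin (n ℕ.+ r)) → (∀ j → ι j ≢ l) → G' (Fin.inject₁ i) l ≡ 0#)

  InExtension : ∀ {k n} → (ℕ → Set) → (r : ℕ) → Matrix k n → Matrix (suc k) (n ℕ.+ r) → Set
  InExtension {k} {n} W r G G' =
    Systematic G' × GeneratesCode (suc k) (n ℕ.+ r) W G' × FirstRowsInserted r G G'

module Submission where

-- The proof is Gaussian elimination.  Reorder the coordinates of G′ so the
-- n = n′ − r columns outside the class of a column j₀ of multiplicity r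
-- come first and the class last (`split`).  Row operations, which keep the
-- code, full rank and proportionality of columns (`RowEquivalent`), turn
-- the first class column into e_k, so every class column vanishes off the
-- last row; further pivots with swaps of non-class columns turn the first
-- k non-class columns into e_0, …, e_{k-1} (`Elimination`).  Then G is the
-- top-left k × n block and G″ the reduced matrix with the class moved to
-- positions k, …, k+r−1 (`BlockSwap`), which is systematic, restricts to G
-- with r zero columns inserted, and is a coordinate permutation of G′
-- (`Extraction`).

open import Defs
open import Level using (0ℓ)
open import Data.Nat as ℕ using (ℕ; zero; suc; _∸_; _≤_; _<_; z≤n; s≤s)
import Data.Nat.Properties as NP
open import Data.Fin as Fin using (Fin; toℕ; _↑ˡ_; _↑ʳ_)
import Data.Fin.Properties as FinP
import Data.Fin.Permutation.Components as PC
open import Data.Vec.Functional using (updateAt; removeAt)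
open import Data.Vec.Functional.Properties using (updateAt-updates; updateAt-minimal)
open import Data.Product using (Σ; ∃; ∃-syntax; _×_; _,_; proj₁; proj₂)
open import Data.Sum using (_⊎_; inj₁; inj₂; [_,_]′)
open import Data.Empty using (⊥-elim)
open import Function using (_∘_; flip)
open import Function.Definitions using (Injective)
open import Function.Bundles using (Inverse; mk↔ₛ′)
open import Relation.Nullary using (¬_; Dec; yes; no)
open import Relation.Nullary.Decidable using (¬?; _×-dec_)
open import Relation.Binary.PropositionalEquality
open import Algebra.Bundles using (CommutativeRing)
open import Algebra.Properties.CommutativeMonoid.Sum NP.+-0-commutativeMonoid
  using (sum-permute) renaming (sum to ℕsum; sum-cong-≗ to ℕsum-cong)

Enumerates : ∀ {m n} (P : Fin n → Set) → (Fin m → Fin n) → Set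
Enumerates P e = Injective _≡_ _≡_ e × (∀ a → P (e a)) × (∀ i → P i → ∃[ a ] (e a ≡ i))

enumerate : ∀ {n} (P : Fin n → Set) → (∀ i → Dec (P i)) →
  Σ ℕ λ m → Σ (Fin m → Fin n) (Enumerates P)
enumerate {zero} P P? = 0 , (λ ()) , (λ { {()} }) , (λ ()) , (λ ())
enumerate {suc n} P P? with enumerate (P ∘ Fin.suc) (P? ∘ Fin.suc) | P? Fin.zero
... | m , e , inj , sound , complete | yes P0 = suc m , e′ , inj′ , sound′ , complete′
  where
  e′ : Fin (suc m) → Fin (suc n)
  e′ Fin.zero = Fin.zero
  e′ (Fin.suc a) = Fin.suc (e a)
  inj′ : Injective _≡_ _≡_ e′
  inj′ {Fin.zero} {Fin.zero} _ = refl
  inj′ {Fin.suc a} {Fin.suc b} eq = cong Fin.suc (inj (FinP.suc-injective eq))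
  sound′ : ∀ a → P (e′ a)
  sound′ Fin.zero = P0
  sound′ (Fin.suc a) = sound a
  complete′ : ∀ i → P i → ∃[ a ] (e′ a ≡ i)
  complete′ Fin.zero _ = Fin.zero , refl
  complete′ (Fin.suc i) Pi with complete i Pi
  ... | a , ea = Fin.suc a , cong Fin.suc ea
... | m , e , inj , sound , complete | no ¬P0 =
  m , Fin.suc ∘ e , inj ∘ FinP.suc-injective , sound , complete′
  where
  complete′ : ∀ i → P i → ∃[ a ] (Fin.suc (e a) ≡ i)
  complete′ Fin.zero P0 = ⊥-elim (¬P0 P0)
  complete′ (Fin.suc i) Pi with complete i Pi
  ... | a , ea = a , cong Fin.suc ea

↑-view : ∀ m {r} (l : Fin (m ℕ.+ r)) → (∃ λ j → l ≡ j ↑ˡ r) ⊎ (∃ λ a → l ≡ m ↑ʳ a)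
↑-view zero l = inj₂ (l , refl)
↑-view (suc m) Fin.zero = inj₁ (Fin.zero , refl)
↑-view (suc m) (Fin.suc l) with ↑-view m l
... | inj₁ (j , e) = inj₁ (Fin.suc j , cong Fin.suc e)
... | inj₂ (a , e) = inj₂ (a , cong Fin.suc e)

↑ˡ≢↑ʳ : ∀ {n r} (j : Fin n) (a : Fin r) → j ↑ˡ r ≢ n ↑ʳ a
↑ˡ≢↑ʳ {n} {r} j a e = NP.<⇒≢ (NP.<-≤-trans (FinP.toℕ<n j) (NP.m≤m+n n (toℕ a)))
  (trans (sym (FinP.toℕ-↑ˡ j r)) (trans (cong toℕ e) (FinP.toℕ-↑ʳ n a)))

last-view : ∀ m (i : Fin (suc m)) → i ≡ Fin.fromℕ m ⊎ ∃ λ i′ → i ≡ Fin.inject₁ i′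
last-view zero Fin.zero = inj₁ refl
last-view (suc m) Fin.zero = inj₂ (Fin.zero , refl)
last-view (suc m) (Fin.suc i) with last-view m i
... | inj₁ e = inj₁ (cong Fin.suc e)
... | inj₂ (i′ , e) = inj₂ (Fin.suc i′ , cong Fin.suc e)

record Split {n′} (P : Fin n′ → Set) (m r : ℕ) : Set where
  field
    f : Fin (m ℕ.+ r) → Fin n′
    f⁻¹ : Fin n′ → Fin (m ℕ.+ r)
    ff⁻¹ : ∀ d → f (f⁻¹ d) ≡ d
    f⁻¹f : ∀ l → f⁻¹ (f l) ≡ l
    inside : ∀ a → P (f (m ↑ʳ a))
    outside : ∀ j → ¬ P (f (j ↑ˡ r))

-- If P holds for exactly r coordinates (enumerated by e₀), then the
-- coordinates split as n′ − r outside P followed by r inside P: join e₀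
-- with an enumeration of the complement.
split : ∀ {n′ r} (P : Fin n′ → Set) → (∀ i → Dec (P i)) → (e₀ : Fin r → Fin n′) → Enumerates P e₀ →
  Split P (n′ ∸ r) r
split {n′} {r} P P? e₀ (inj₀ , sound₀ , complete₀) with enumerate (¬_ ∘ P) (¬? ∘ P?)
... | m , eN , injN , soundN , completeN = subst (λ m → Split P m r) m≡n′∸r S
  where
  f : Fin (m ℕ.+ r) → Fin n′
  f l = [ eN , e₀ ]′ (Fin.splitAt m l)
  f-↑ˡ : ∀ j → f (j ↑ˡ r) ≡ eN j
  f-↑ˡ j rewrite FinP.splitAt-↑ˡ m j r = refl
  f-↑ʳ : ∀ a → f (m ↑ʳ a) ≡ e₀ a
  f-↑ʳ a rewrite FinP.splitAt-↑ʳ m r a = refl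
  locate : ∀ d → Dec (P d) → Fin (m ℕ.+ r)
  locate d (yes Pd) = m ↑ʳ proj₁ (complete₀ d Pd)
  locate d (no ¬Pd) = proj₁ (completeN d ¬Pd) ↑ˡ r
  f⁻¹ : Fin n′ → Fin (m ℕ.+ r)
  f⁻¹ d = locate d (P? d)
  f-locate : ∀ d (P?d : Dec (P d)) → f (locate d P?d) ≡ d
  f-locate d (yes Pd) = trans (f-↑ʳ _) (proj₂ (complete₀ d Pd))
  f-locate d (no ¬Pd) = trans (f-↑ˡ _) (proj₂ (completeN d ¬Pd))
  locate-f : ∀ l (P?fl : Dec (P (f l))) → locate (f l) P?fl ≡ l
  locate-f l P?fl with ↑-view m l
  locate-f l (yes Pfl) | inj₁ (j , refl) = ⊥-elim (soundN j (subst P (f-↑ˡ j) Pfl))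
  locate-f l (no ¬Pfl) | inj₁ (j , refl) = cong (_↑ˡ r) (injN (trans (proj₂ (completeN _ ¬Pfl)) (f-↑ˡ j)))
  locate-f l (yes Pfl) | inj₂ (a , refl) = cong (m ↑ʳ_) (inj₀ (trans (proj₂ (complete₀ _ Pfl)) (f-↑ʳ a)))
  locate-f l (no ¬Pfl) | inj₂ (a , refl) = ⊥-elim (¬Pfl (subst P (sym (f-↑ʳ a)) (sound₀ a)))
  S : Split P m r
  S = record
    { f = f ; f⁻¹ = f⁻¹
    ; ff⁻¹ = λ d → f-locate d (P? d)
    ; f⁻¹f = λ l → locate-f l (P? (f l))
    ; inside = λ a → subst P (sym (f-↑ʳ a)) (sound₀ a)
    ; outside = λ j → subst (¬_ ∘ P) (sym (f-↑ˡ j)) (soundN j) }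
  m≡n′∸r : m ≡ n′ ∸ r
  m≡n′∸r = trans (sym (NP.m+n∸n≡m m r)) (cong (_∸ r) (FinP.cantor-schröder-bernstein
    (λ {x} {y} e → trans (sym (Split.f⁻¹f S x)) (trans (cong f⁻¹ e) (Split.f⁻¹f S y)))
    (λ {x} {y} e → trans (sym (Split.ff⁻¹ S x)) (trans (cong f e) (Split.ff⁻¹ S y)))))

transpose-fixes : ∀ {m} {x y l : Fin m} → l ≢ x → l ≢ y → PC.transpose x y l ≡ l
transpose-fixes {x = x} {y} {l} l≢x l≢y with l Fin.≟ x
... | yes l≡x = ⊥-elim (l≢x l≡x)
... | no _ with l Fin.≟ y
... | yes l≡y = ⊥-elim (l≢y l≡y)
... | no _ = refl

transpose-moves : ∀ {m} (x y : Fin m) → PC.transpose x y x ≡ y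
transpose-moves x y with x Fin.≟ x
... | yes _ = refl
... | no x≢x = ⊥-elim (x≢x refl)

transpose-cases : ∀ {m} (x y l : Fin m) →
  PC.transpose x y l ≡ y ⊎ PC.transpose x y l ≡ x ⊎ PC.transpose x y l ≡ l
transpose-cases x y l with l Fin.≟ x
... | yes _ = inj₁ refl
... | no _ with l Fin.≟ y
... | yes _ = inj₂ (inj₁ refl)
... | no _ = inj₂ (inj₂ refl)

-- The coordinate permutation behind G″.  On Fin (n + r) with k ≤ n and
-- r = suc r₀, ψ fixes the positions below k, sends the block [k, k + r)
-- onto the last block [n, n + r), and shifts [k + r, n + r) down onto
-- [k, n); θ is its inverse.  It is defined on ℕ first (Ψ, Θ), and θ is
-- increasing on the first n positions.
module BlockSwap (k n r₀ : ℕ) (k≤n : k ≤ n) where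
  r N : ℕ
  r = suc r₀
  N = n ℕ.+ r

  Ψ : ℕ → ℕ
  Ψ x with x NP.<? k
  ... | yes _ = x
  ... | no _ with x NP.<? k ℕ.+ r
  ... | yes _ = n ℕ.+ (x ∸ k)
  ... | no _ = x ∸ r

  Θ : ℕ → ℕ
  Θ y with y NP.<? k
  ... | yes _ = y
  ... | no _ with y NP.<? n
  ... | yes _ = y ℕ.+ r
  ... | no _ = k ℕ.+ (y ∸ n)

  Ψ-lo : ∀ x → x < k → Ψ x ≡ x
  Ψ-lo x x<k with x NP.<? k
  ... | yes _ = refl
  ... | no x≮k = ⊥-elim (x≮k x<k)

  Ψ-mid : ∀ x → k ≤ x → x < k ℕ.+ r → Ψ x ≡ n ℕ.+ (x ∸ k)
  Ψ-mid x k≤x x<k+r with x NP.<? k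
  ... | yes x<k = ⊥-elim (NP.<⇒≱ x<k k≤x)
  ... | no _ with x NP.<? k ℕ.+ r
  ... | yes _ = refl
  ... | no x≮k+r = ⊥-elim (x≮k+r x<k+r)

  Ψ-hi : ∀ x → k ℕ.+ r ≤ x → Ψ x ≡ x ∸ r
  Ψ-hi x k+r≤x with x NP.<? k
  ... | yes x<k = ⊥-elim (NP.<⇒≱ x<k (NP.≤-trans (NP.m≤m+n k r) k+r≤x))
  ... | no _ with x NP.<? k ℕ.+ r
  ... | yes x<k+r = ⊥-elim (NP.<⇒≱ x<k+r k+r≤x)
  ... | no _ = refl

  Θ-lo : ∀ y → y < k → Θ y ≡ y
  Θ-lo y y<k with y NP.<? k
  ... | yes _ = refl
  ... | no y≮k = ⊥-elim (y≮k y<k)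

  Θ-mid : ∀ y → k ≤ y → y < n → Θ y ≡ y ℕ.+ r
  Θ-mid y k≤y y<n with y NP.<? k
  ... | yes y<k = ⊥-elim (NP.<⇒≱ y<k k≤y)
  ... | no _ with y NP.<? n
  ... | yes _ = refl
  ... | no y≮n = ⊥-elim (y≮n y<n)

  Θ-hi : ∀ y → n ≤ y → Θ y ≡ k ℕ.+ (y ∸ n)
  Θ-hi y n≤y with y NP.<? k
  ... | yes y<k = ⊥-elim (NP.<⇒≱ y<k (NP.≤-trans k≤n n≤y))
  ... | no _ with y NP.<? n
  ... | yes y<n = ⊥-elim (NP.<⇒≱ y<n n≤y)
  ... | no _ = refl

  Ψ-bounded : ∀ x → x < N → Ψ x < N
  Ψ-bounded x x<N with x NP.<? k
  ... | yes _ = x<N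
  ... | no _ with x NP.<? k ℕ.+ r
  ... | yes x<k+r = NP.+-monoʳ-< n (NP.m<n+o⇒m∸n<o x k x<k+r)
  ... | no x≮k+r = NP.<-≤-trans
    (subst (x ∸ r <_) (NP.m+n∸n≡m n r) (NP.∸-monoˡ-< x<N (NP.≤-trans (NP.m≤n+m r k) (NP.≮⇒≥ x≮k+r))))
    (NP.m≤m+n n r)

  Θ-bounded : ∀ y → y < N → Θ y < N
  Θ-bounded y y<N with y NP.<? k
  ... | yes _ = y<N
  ... | no _ with y NP.<? n
  ... | yes y<n = NP.+-monoˡ-< r y<n
  ... | no _ = NP.<-≤-trans (NP.+-monoʳ-< k (NP.m<n+o⇒m∸n<o y n y<N)) (NP.+-monoˡ-≤ r k≤n)

  ΨΘ : ∀ y → y < N → Ψ (Θ y) ≡ y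
  ΨΘ y y<N with y NP.<? k
  ... | yes y<k = Ψ-lo y y<k
  ... | no y≮k with y NP.<? n
  ... | yes _ = trans (Ψ-hi (y ℕ.+ r) (NP.+-monoˡ-≤ r (NP.≮⇒≥ y≮k))) (NP.m+n∸n≡m y r)
  ... | no y≮n = trans (Ψ-mid _ (NP.m≤m+n k _) (NP.+-monoʳ-< k (NP.m<n+o⇒m∸n<o y n y<N)))
                  (trans (cong (n ℕ.+_) (NP.m+n∸m≡n k (y ∸ n))) (NP.m+[n∸m]≡n (NP.≮⇒≥ y≮n)))

  ΘΨ : ∀ x → x < N → Θ (Ψ x) ≡ x
  ΘΨ x x<N with x NP.<? k
  ... | yes x<k = Θ-lo x x<k
  ... | no x≮k with x NP.<? k ℕ.+ r
  ... | yes _ = trans (Θ-hi _ (NP.m≤m+n n _))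
                  (trans (cong (k ℕ.+_) (NP.m+n∸m≡n n (x ∸ k))) (NP.m+[n∸m]≡n (NP.≮⇒≥ x≮k)))
  ... | no x≮k+r = trans (Θ-mid _ k≤x∸r x∸r<n) (NP.m∸n+n≡m r≤x)
    where
    r≤x : r ≤ x
    r≤x = NP.≤-trans (NP.m≤n+m r k) (NP.≮⇒≥ x≮k+r)
    k≤x∸r : k ≤ x ∸ r
    k≤x∸r = subst (_≤ x ∸ r) (NP.m+n∸n≡m k r) (NP.∸-monoˡ-≤ r (NP.≮⇒≥ x≮k+r))
    x∸r<n : x ∸ r < n
    x∸r<n = subst (x ∸ r <_) (NP.m+n∸n≡m n r) (NP.∸-monoˡ-< x<N r≤x)

  Θ-mono : ∀ a b → a < b → b < n → Θ a < Θ b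
  Θ-mono a b a<b b<n = by-cases (a NP.<? k) (b NP.<? k)
    where
    by-cases : Dec (a < k) → Dec (b < k) → Θ a < Θ b
    by-cases (yes a<k) (yes b<k) = subst₂ _<_ (sym (Θ-lo a a<k)) (sym (Θ-lo b b<k)) a<b
    by-cases (yes a<k) (no b≮k) =
      subst₂ _<_ (sym (Θ-lo a a<k)) (sym (Θ-mid b (NP.≮⇒≥ b≮k) b<n)) (NP.<-≤-trans a<b (NP.m≤m+n b r))
    by-cases (no a≮k) (yes b<k) = ⊥-elim (a≮k (NP.<-trans a<b b<k))
    by-cases (no a≮k) (no b≮k) =
      subst₂ _<_ (sym (Θ-mid a (NP.≮⇒≥ a≮k) (NP.<-trans a<b b<n))) (sym (Θ-mid b (NP.≮⇒≥ b≮k) b<n)) (NP.+-monoˡ-< r a<b)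

  ψ : Fin N → Fin N
  ψ l = Fin.fromℕ< (Ψ-bounded (toℕ l) (FinP.toℕ<n l))

  θ : Fin N → Fin N
  θ l = Fin.fromℕ< (Θ-bounded (toℕ l) (FinP.toℕ<n l))

  tψ : ∀ l → toℕ (ψ l) ≡ Ψ (toℕ l)
  tψ l = FinP.toℕ-fromℕ< _

  tθ : ∀ l → toℕ (θ l) ≡ Θ (toℕ l)
  tθ l = FinP.toℕ-fromℕ< _

  ψθ : ∀ l → ψ (θ l) ≡ l
  ψθ l = FinP.toℕ-injective (trans (tψ (θ l)) (trans (cong Ψ (tθ l)) (ΨΘ (toℕ l) (FinP.toℕ<n l))))

  θψ : ∀ l → θ (ψ l) ≡ l
  θψ l = FinP.toℕ-injective (trans (tθ (ψ l)) (trans (cong Θ (tψ l)) (ΘΨ (toℕ l) (FinP.toℕ<n l))))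

  ψ-lo : ∀ l → toℕ l < k → Σ (Fin n) λ j → ψ l ≡ j ↑ˡ r × toℕ j ≡ toℕ l
  ψ-lo l l<k = j , FinP.toℕ-injective (trans (tψ l) (trans (Ψ-lo _ l<k) (trans (sym j≡l) (sym (FinP.toℕ-↑ˡ j r))))) , j≡l
    where
    j : Fin n
    j = Fin.fromℕ< (NP.<-≤-trans l<k k≤n)
    j≡l : toℕ j ≡ toℕ l
    j≡l = FinP.toℕ-fromℕ< (NP.<-≤-trans l<k k≤n)

  ψ-k : ∀ l → toℕ l ≡ k → ψ l ≡ n ↑ʳ Fin.zero
  ψ-k l l≡k = FinP.toℕ-injective (trans (tψ l) (trans (cong Ψ l≡k) (trans (Ψ-mid k NP.≤-refl (NP.m<m+n k (s≤s z≤n)))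
              (trans (cong (n ℕ.+_) (NP.n∸n≡0 k)) (sym (FinP.toℕ-↑ʳ n (Fin.zero {r₀})))))))

  θ-increasing : ∀ (a b : Fin n) → a Fin.< b → θ (a ↑ˡ r) Fin.< θ (b ↑ˡ r)
  θ-increasing a b a<b = subst₂ _<_ (sym (θ↑ˡ a)) (sym (θ↑ˡ b)) (Θ-mono (toℕ a) (toℕ b) a<b (FinP.toℕ<n b))
    where
    θ↑ˡ : ∀ j → toℕ (θ (j ↑ˡ r)) ≡ Θ (toℕ j)
    θ↑ˡ j = trans (tθ (j ↑ˡ r)) (cong Θ (FinP.toℕ-↑ˡ j r))

module Field (F : FiniteField) where
  open FiniteField F public

  commutativeRing : CommutativeRing 0ℓ 0ℓ
  commutativeRing = record { isCommutativeRing = isCommutativeRing }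

  open CommutativeRing commutativeRing public
    using ( +-assoc; *-assoc; *-comm; +-identityˡ; +-identityʳ; *-identityˡ; *-identityʳ
          ; distribˡ; distribʳ; zeroˡ; zeroʳ; -‿inverseʳ; semiring; ring)
  open import Algebra.Properties.Ring ring public using (-0#≈0#)
  open import Algebra.Properties.Semiring.Sum semiring public
    using (sum; sum-cong-≗; ∑-distrib-+; *-distribʳ-sum; sum-replicate-zero; sum-remove)

  1≢0 : 1# ≢ 0#
  1≢0 = 0≢1 ∘ sym

  inv : ∀ x → x ≢ 0# → Carrier
  inv x x≢0 = proj₁ (inverse x x≢0)

  inv-l : ∀ x (x≢0 : x ≢ 0#) → inv x x≢0 * x ≡ 1#
  inv-l x x≢0 = trans (*-comm _ x) (proj₂ (inverse x x≢0))

  inv-nz : ∀ x (x≢0 : x ≢ 0#) → inv x x≢0 ≢ 0#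
  inv-nz x x≢0 inv≡0 = 0≢1 (begin
    0#            ≡⟨ sym (zeroˡ x) ⟩
    0# * x        ≡⟨ cong (_* x) (sym inv≡0) ⟩
    inv x x≢0 * x ≡⟨ inv-l x x≢0 ⟩
    1#            ∎)
    where open ≡-Reasoning

  cancel-nonzeroʳ : ∀ x y → y ≢ 0# → x * y ≡ 0# → x ≡ 0#
  cancel-nonzeroʳ x y y≢0 xy≡0 = begin
    x                     ≡⟨ sym (*-identityʳ x) ⟩
    x * 1#                ≡⟨ cong (x *_) (sym (inv-l y y≢0)) ⟩
    x * (inv y y≢0 * y)   ≡⟨ cong (x *_) (*-comm _ y) ⟩
    x * (y * inv y y≢0)   ≡⟨ sym (*-assoc x y _) ⟩
    x * y * inv y y≢0     ≡⟨ cong (_* inv y y≢0) xy≡0 ⟩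
    0# * inv y y≢0        ≡⟨ zeroˡ _ ⟩
    0#                    ∎
    where open ≡-Reasoning

  Σ≡sum : ∀ {n} (f : Fin n → Carrier) → Σ[<_]_ F n f ≡ sum f
  Σ≡sum {zero} f = refl
  Σ≡sum {suc n} f = cong (f Fin.zero +_) (Σ≡sum (f ∘ Fin.suc))

  encode≡sum : ∀ {k n} (G : Matrix F k n) x j → encode F G x j ≡ sum (λ i → x i * G i j)
  encode≡sum {k} G x j = Σ≡sum {k} (λ i → x i * G i j)

  sum-zero : ∀ {n} {f : Fin n → Carrier} → (∀ i → f i ≡ 0#) → sum f ≡ 0#
  sum-zero {n} f≡0 = trans (sum-cong-≗ f≡0) (sum-replicate-zero n)

  sum-supported : ∀ {n} (p : Fin n) (f : Fin n → Carrier) → (∀ i → i ≢ p → f i ≡ 0#) → sum f ≡ f p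
  sum-supported {suc n} p f off = begin
    sum f                   ≡⟨ sum-remove {i = p} f ⟩
    f p + sum (removeAt f p) ≡⟨ cong (f p +_) (sum-zero (λ j → off _ (FinP.punchInᵢ≢i p j))) ⟩
    f p + 0#                ≡⟨ +-identityʳ _ ⟩
    f p                     ∎
    where open ≡-Reasoning

  single : ∀ {k} → Fin k → Carrier → Vector F k
  single p s = updateAt (λ _ → 0#) p (λ _ → s)

  single-at : ∀ {k} (p : Fin k) s → single p s p ≡ s
  single-at p s = updateAt-updates p (λ _ → 0#)

  single-off : ∀ {k} {p i : Fin k} s → i ≢ p → single p s i ≡ 0#
  single-off {p = p} {i} s i≢p = updateAt-minimal i p (λ _ → 0#) i≢p

  sum-single : ∀ {k} (p : Fin k) s (g : Fin k → Carrier) → sum (λ i → single p s i * g i) ≡ s * g p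
  sum-single p s g =
    trans (sum-supported p _ (λ i i≢p → trans (cong (_* g i) (single-off s i≢p)) (zeroˡ _)))
          (cong (_* g p) (single-at p s))

  row-in-code : ∀ {k n} (G : Matrix F k n) (i : Fin k) s → InCode F G (λ j → s * G i j)
  row-in-code G i s = single i s , λ j → trans (encode≡sum G _ j) (sum-single i s (λ l → G l j))

  InCode-cong : ∀ {k n} (G : Matrix F k n) {v w : Vector F n} → InCode F G v → (∀ j → v j ≡ w j) → InCode F G w
  InCode-cong G (x , e) v≡w = x , λ j → trans (e j) (v≡w j)

  inspan-refl : ∀ {k} (g : Vector F k) → InSpan F g g
  inspan-refl g = 1# , λ i → sym (*-identityˡ (g i))

  inspan-trans : ∀ {k} {g h v : Vector F k} → InSpan F g h → InSpan F h v → InSpan F g v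
  inspan-trans {g = g} (a , h≡ag) (b , v≡bh) =
    b * a , λ i → trans (v≡bh i) (trans (cong (b *_) (h≡ag i)) (sym (*-assoc b a (g i))))

  samespan⇒ : ∀ {k} {g h : Vector F k} → SameSpan F g h → InSpan F g h × InSpan F h g
  samespan⇒ {g = g} {h} g~h = proj₂ (g~h h) (inspan-refl h) , proj₁ (g~h g) (inspan-refl g)

  samespan⇐ : ∀ {k} {g h : Vector F k} → InSpan F g h → InSpan F h g → SameSpan F g h
  samespan⇐ g∋h h∋g v = inspan-trans h∋g , inspan-trans g∋h

  samespan-sym : ∀ {k} {g h : Vector F k} → SameSpan F g h → SameSpan F h g
  samespan-sym g~h = samespan⇐ (proj₂ (samespan⇒ g~h)) (proj₁ (samespan⇒ g~h))

  samespan-trans : ∀ {k} {g h v : Vector F k} → SameSpan F g h → SameSpan F h v → SameSpan F g v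
  samespan-trans g~h h~v =
    samespan⇐ (inspan-trans (proj₁ (samespan⇒ g~h)) (proj₁ (samespan⇒ h~v)))
              (inspan-trans (proj₂ (samespan⇒ h~v)) (proj₂ (samespan⇒ g~h)))

  inspan? : ∀ {k} (g h : Vector F k) → Dec (InSpan F g h)
  inspan? g h with FinP.any? (λ t → FinP.all? (λ i → h i ≟ (Inverse.from finite t * g i)))
  ... | yes (t , h≡tg) = yes (Inverse.from finite t , h≡tg)
  ... | no ¬∃ = no λ (a , h≡ag) →
    ¬∃ (Inverse.to finite a , λ i → trans (h≡ag i) (cong (_* g i) (sym (Inverse.strictlyInverseʳ finite a))))

  samespan? : ∀ {k} (g h : Vector F k) → Dec (SameSpan F g h)
  samespan? g h with inspan? g h | inspan? h g
  ... | yes g∋h | yes h∋g = yes (samespan⇐ g∋h h∋g)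
  ... | no g∌h | _ = no (g∌h ∘ proj₁ ∘ samespan⇒)
  ... | _ | no h∌g = no (h∌g ∘ proj₂ ∘ samespan⇒)

  -- Weights.  wt v counts the non-zero coordinates of v; as a sum of 0/1
  -- indicators it is invariant under permuting coordinates and additive
  -- over a splitting of the coordinates into two blocks.
  nonzero : Carrier → ℕ
  nonzero x with x ≟ 0#
  ... | yes _ = 0
  ... | no _ = 1

  wt≡count : ∀ {n} (v : Vector F n) → wt F v ≡ ℕsum (nonzero ∘ v)
  wt≡count {zero} v = refl
  wt≡count {suc n} v with v Fin.zero ≟ 0#
  ... | yes _ = wt≡count (v ∘ Fin.suc)
  ... | no _ = cong suc (wt≡count (v ∘ Fin.suc))

  wt-cong : ∀ {n} {v w : Vector F n} → (∀ j → v j ≡ w j) → wt F v ≡ wt F w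
  wt-cong {v = v} {w} v≡w =
    trans (wt≡count v) (trans (ℕsum-cong (cong nonzero ∘ v≡w)) (sym (wt≡count w)))

  wt-permute : ∀ {m n} (π : Fin m → Fin n) (π⁻¹ : Fin n → Fin m) →
               (∀ j → π (π⁻¹ j) ≡ j) → (∀ l → π⁻¹ (π l) ≡ l) →
               (v : Vector F n) → wt F (v ∘ π) ≡ wt F v
  wt-permute π π⁻¹ ππ⁻¹ π⁻¹π v = begin
    wt F (v ∘ π)          ≡⟨ wt≡count (v ∘ π) ⟩
    ℕsum (nonzero ∘ v ∘ π) ≡⟨ sym (sum-permute (nonzero ∘ v) (mk↔ₛ′ π π⁻¹ ππ⁻¹ π⁻¹π)) ⟩
    ℕsum (nonzero ∘ v)     ≡⟨ sym (wt≡count v) ⟩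
    wt F v                 ∎
    where open ≡-Reasoning

  wt-zero : ∀ {n} (v : Vector F n) → IsZero F v → wt F v ≡ 0
  wt-zero {zero} v v≡0 = refl
  wt-zero {suc n} v v≡0 with v Fin.zero ≟ 0#
  ... | yes _ = wt-zero (v ∘ Fin.suc) (v≡0 ∘ Fin.suc)
  ... | no v0≢0 = ⊥-elim (v0≢0 (v≡0 Fin.zero))

  wt-split : ∀ m {r} (w : Vector F (m ℕ.+ r)) → wt F w ≡ wt F (λ j → w (j ↑ˡ r)) ℕ.+ wt F (λ a → w (m ↑ʳ a))
  wt-split zero w = refl
  wt-split (suc m) w with w Fin.zero ≟ 0#
  ... | yes _ = wt-split m (w ∘ Fin.suc)
  ... | no _ = cong suc (wt-split m (w ∘ Fin.suc))

  permute-code⇒ : ∀ {k m n} (M : Matrix F k n) (π : Fin m → Fin n) (π⁻¹ : Fin n → Fin m) →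
    (∀ j → π (π⁻¹ j) ≡ j) → ∀ w → InCode F (λ i l → M i (π l)) w → InCode F M (w ∘ π⁻¹)
  permute-code⇒ M π π⁻¹ ππ⁻¹ w (x , e) = x , λ j → trans (cong (encode F M x) (sym (ππ⁻¹ j))) (e (π⁻¹ j))

  permute-code⇐ : ∀ {k m n} (M : Matrix F k n) (π : Fin m → Fin n) (π⁻¹ : Fin n → Fin m) →
    (∀ l → π⁻¹ (π l) ≡ l) → ∀ w → InCode F M (w ∘ π⁻¹) → InCode F (λ i l → M i (π l)) w
  permute-code⇐ M π π⁻¹ π⁻¹π w (x , e) = x , λ l → trans (e (π l)) (cong w (π⁻¹π l))

  permute-fullRank : ∀ {k m n} (M : Matrix F k n) (π : Fin m → Fin n) (π⁻¹ : Fin n → Fin m) →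
    (∀ j → π (π⁻¹ j) ≡ j) → FullRank F M → FullRank F (λ i l → M i (π l))
  permute-fullRank M π π⁻¹ ππ⁻¹ fr x xM≡0 =
    fr x λ j → trans (cong (encode F M x) (sym (ππ⁻¹ j))) (xM≡0 (π⁻¹ j))

  -- A systematic matrix (I_k | R) has full rank: coordinate i of xG is x_i.
  systematic⇒fullRank : ∀ {k n} (G : Matrix F k n) → Systematic F G → FullRank F G
  systematic⇒fullRank {k} {n} G (k≤n , unit) x xG≡0 i = begin
    x i                     ≡⟨ sym (*-identityʳ (x i)) ⟩
    x i * 1#                ≡⟨ cong (x i *_) (sym (proj₁ (unit i j j<k) (sym j≡i))) ⟩
    x i * G i j             ≡⟨ sym (sum-supported i (λ l → x l * G l j) off-diagonal) ⟩
    sum (λ l → x l * G l j) ≡⟨ sym (encode≡sum G x j) ⟩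
    encode F G x j          ≡⟨ xG≡0 j ⟩
    0#                      ∎
    where
    open ≡-Reasoning
    j : Fin n
    j = Fin.inject≤ i k≤n
    j≡i : toℕ j ≡ toℕ i
    j≡i = FinP.toℕ-inject≤ i k≤n
    j<k : toℕ j < k
    j<k = subst (_< k) (sym j≡i) (FinP.toℕ<n i)
    off-diagonal : ∀ l → l ≢ i → x l * G l j ≡ 0#
    off-diagonal l l≢i =
      trans (cong (x l *_) (proj₂ (unit l j j<k) (λ e → l≢i (FinP.toℕ-injective (trans e j≡i))))) (zeroʳ _)

  nonzeroColumns⇒effectiveLength : ∀ {k n} (G : Matrix F k n) → (∀ j → ∃[ i ] (G i j ≢ 0#)) → EffectiveLength F G
  nonzeroColumns⇒effectiveLength G nz j with nz j
  ... | i , Gij≢0 = (λ j′ → 1# * G i j′) , row-in-code G i 1# , λ e → Gij≢0 (trans (sym (*-identityˡ _)) e)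

  effectiveLength⇒nonzeroColumns : ∀ {k n} (G : Matrix F k n) → EffectiveLength F G → ∀ j → ∃[ i ] (G i j ≢ 0#)
  effectiveLength⇒nonzeroColumns G el j with FinP.any? (λ i → ¬? (G i j ≟ 0#))
  ... | yes found = found
  ... | no none with el j
  ... | v , (x , e) , vj≢0 = ⊥-elim (vj≢0 (begin
    v j                     ≡⟨ sym (e j) ⟩
    encode F G x j          ≡⟨ encode≡sum G x j ⟩
    sum (λ i → x i * G i j) ≡⟨ sum-zero (λ i → trans (cong (x i *_) (column-zero i)) (zeroʳ _)) ⟩
    0#                      ∎))
    where
    open ≡-Reasoning
    column-zero : ∀ i → G i j ≡ 0#
    column-zero i with G i j ≟ 0#
    ... | yes Gij≡0 = Gij≡0
    ... | no Gij≢0 = ⊥-elim (none (i , Gij≢0))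

  record RowEquivalent {k n} (H H′ : Matrix F k n) : Set where
    field
      code⇒ : ∀ v → InCode F H v → InCode F H′ v
      code⇐ : ∀ v → InCode F H′ v → InCode F H v
      span⇒ : ∀ l l′ → InSpan F (column F H l) (column F H l′) → InSpan F (column F H′ l) (column F H′ l′)
      span⇐ : ∀ l l′ → InSpan F (column F H′ l) (column F H′ l′) → InSpan F (column F H l) (column F H l′)
      fullRank⇒ : FullRank F H → FullRank F H′

  rowEquivalent-trans : ∀ {k n} {H₁ H₂ H₃ : Matrix F k n} →
    RowEquivalent H₁ H₂ → RowEquivalent H₂ H₃ → RowEquivalent H₁ H₃
  rowEquivalent-trans A B = record
    { code⇒ = λ v → B.code⇒ v ∘ A.code⇒ v
    ; code⇐ = λ v → A.code⇐ v ∘ B.code⇐ v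
    ; span⇒ = λ l l′ → B.span⇒ l l′ ∘ A.span⇒ l l′
    ; span⇐ = λ l l′ → A.span⇐ l l′ ∘ B.span⇐ l l′
    ; fullRank⇒ = B.fullRank⇒ ∘ A.fullRank⇒ }
    where
    module A = RowEquivalent A
    module B = RowEquivalent B

  record RowOperation {k n} (H H′ : Matrix F k n) : Set where
    field
      φ : Vector F k → Vector F k
      encode-φ : ∀ x j → encode F H′ x j ≡ encode F H (φ x) j
      φ-injective : ∀ x → IsZero F (φ x) → IsZero F x
      span-preserved : ∀ l l′ → InSpan F (column F H l) (column F H l′) → InSpan F (column F H′ l) (column F H′ l′)

    code⇐ : ∀ v → InCode F H′ v → InCode F H v
    code⇐ v (x , e) = φ x , λ j → trans (sym (encode-φ x j)) (e j)

    fullRank⇒ : FullRank F H → FullRank F H′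
    fullRank⇒ fr x xH′≡0 = φ-injective x (fr (φ x) λ j → trans (sym (encode-φ x j)) (xH′≡0 j))

  rowEquivalent : ∀ {k n} {H H′ : Matrix F k n} → RowOperation H H′ → RowOperation H′ H → RowEquivalent H H′
  rowEquivalent A B = record
    { code⇒ = B.code⇐ ; code⇐ = A.code⇐
    ; span⇒ = A.span-preserved ; span⇐ = B.span-preserved ; fullRank⇒ = A.fullRank⇒ }
    where
    module A = RowOperation A
    module B = RowOperation B

  module AddMultiple {k n} (H H′ : Matrix F k n) (p : Fin k) (c : Fin k → Carrier) (c-p : c p ≡ 0#)
                     (H′≡ : ∀ i j → H′ i j ≡ H i j + c i * H p j) where
    s : Vector F k → Carrier
    s x = sum (λ i → x i * c i)

    φ : Vector F k → Vector F k
    φ x i = x i + single p (s x) i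

    encode-φ : ∀ x j → encode F H′ x j ≡ encode F H (φ x) j
    encode-φ x j = begin
      encode F H′ x j                                  ≡⟨ encode≡sum H′ x j ⟩
      sum (λ i → x i * H′ i j)                         ≡⟨ sum-cong-≗ (λ i → trans (cong (x i *_) (H′≡ i j)) (distribˡ (x i) _ _)) ⟩
      sum (λ i → x i * H i j + x i * (c i * H p j))    ≡⟨ ∑-distrib-+ (λ i → x i * H i j) _ ⟩
      sum (λ i → x i * H i j) + sum (λ i → x i * (c i * H p j))
        ≡⟨ cong (sum (λ i → x i * H i j) +_) (trans (sum-cong-≗ (λ i → sym (*-assoc (x i) (c i) (H p j))))
                                                     (sym (*-distribʳ-sum (H p j) (λ i → x i * c i)))) ⟩
      sum (λ i → x i * H i j) + s x * H p j            ≡⟨ cong (sum (λ i → x i * H i j) +_) (sym (sum-single p (s x) (λ i → H i j))) ⟩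
      sum (λ i → x i * H i j) + sum (λ i → single p (s x) i * H i j)
        ≡⟨ sym (∑-distrib-+ (λ i → x i * H i j) _) ⟩
      sum (λ i → x i * H i j + single p (s x) i * H i j) ≡⟨ sum-cong-≗ (λ i → sym (distribʳ (H i j) (x i) _)) ⟩
      sum (λ i → φ x i * H i j)                        ≡⟨ sym (encode≡sum H (φ x) j) ⟩
      encode F H (φ x) j                               ∎
      where open ≡-Reasoning

    -- If φ x = 0 then x vanishes off p, so s x = x_p c_p = 0 and x_p = 0 too.
    φ-injective : ∀ x → IsZero F (φ x) → IsZero F x
    φ-injective x φx≡0 = x≡0
      where
      off-p : ∀ i → i ≢ p → x i ≡ 0#
      off-p i i≢p = trans (sym (+-identityʳ (x i))) (trans (cong (x i +_) (sym (single-off (s x) i≢p))) (φx≡0 i))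
      s≡0 : s x ≡ 0#
      s≡0 = trans (sum-supported p _ (λ i i≢p → trans (cong (_* c i) (off-p i i≢p)) (zeroˡ _)))
                  (trans (cong (x p *_) c-p) (zeroʳ _))
      x≡0 : IsZero F x
      x≡0 i with i Fin.≟ p
      ... | no i≢p = off-p i i≢p
      ... | yes refl = trans (sym (+-identityʳ (x p))) (trans (cong (x p +_) (sym (trans (single-at p (s x)) s≡0))) (φx≡0 p))

    span-preserved : ∀ l l′ → InSpan F (column F H l) (column F H l′) → InSpan F (column F H′ l) (column F H′ l′)
    span-preserved l l′ (a , e) = a , λ i → begin
      H′ i l′                       ≡⟨ H′≡ i l′ ⟩
      H i l′ + c i * H p l′         ≡⟨ cong₂ (λ u w → u + c i * w) (e i) (e p) ⟩
      a * H i l + c i * (a * H p l) ≡⟨ cong (a * H i l +_) (trans (sym (*-assoc (c i) a _)) (trans (cong (_* H p l) (*-comm (c i) a)) (*-assoc a (c i) _))) ⟩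
      a * H i l + a * (c i * H p l) ≡⟨ sym (distribˡ a _ _) ⟩
      a * (H i l + c i * H p l)     ≡⟨ cong (a *_) (sym (H′≡ i l)) ⟩
      a * H′ i l                    ∎
      where open ≡-Reasoning

    operation : RowOperation H H′
    operation = record { φ = φ ; encode-φ = encode-φ ; φ-injective = φ-injective ; span-preserved = span-preserved }

    -- Undone by adding -c_i times row p (which row p itself is unchanged).
    undo : ∀ i j → H i j ≡ H′ i j + (- c i) * H′ p j
    undo i j = sym (begin
      H′ i j + (- c i) * H′ p j                ≡⟨ cong₂ (λ u w → u + (- c i) * w) (H′≡ i j) H′-p ⟩
      (H i j + c i * H p j) + (- c i) * H p j  ≡⟨ +-assoc (H i j) _ _ ⟩
      H i j + (c i * H p j + (- c i) * H p j)  ≡⟨ cong (H i j +_) (sym (distribʳ (H p j) (c i) (- c i))) ⟩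
      H i j + (c i + - c i) * H p j            ≡⟨ cong (λ t → H i j + t * H p j) (-‿inverseʳ (c i)) ⟩
      H i j + 0# * H p j                       ≡⟨ cong (H i j +_) (zeroˡ _) ⟩
      H i j + 0#                               ≡⟨ +-identityʳ _ ⟩
      H i j                                    ∎)
      where
      open ≡-Reasoning
      H′-p : H′ p j ≡ H p j
      H′-p = trans (H′≡ p j) (trans (cong (λ t → H p j + t * H p j) c-p) (trans (cong (H p j +_) (zeroˡ _)) (+-identityʳ _)))

  addMultiple : ∀ {k n} (H H′ : Matrix F k n) (p : Fin k) (c : Fin k → Carrier) → c p ≡ 0# →
    (∀ i j → H′ i j ≡ H i j + c i * H p j) → RowEquivalent H H′
  addMultiple H H′ p c c-p H′≡ = rowEquivalent A.operation B.operation
    where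
    module A = AddMultiple H H′ p c c-p H′≡
    module B = AddMultiple H′ H p (λ i → - c i) (trans (cong -_ c-p) -0#≈0#) A.undo

  module Scale {k n} (H H′ : Matrix F k n) (d : Fin k → Carrier) (d≢0 : ∀ i → d i ≢ 0#)
               (H′≡ : ∀ i j → H′ i j ≡ d i * H i j) where
    operation : RowOperation H H′
    operation = record
      { φ = λ x i → x i * d i
      ; encode-φ = λ x j → trans (encode≡sum H′ x j) (trans
          (sum-cong-≗ (λ i → trans (cong (x i *_) (H′≡ i j)) (sym (*-assoc (x i) (d i) (H i j)))))
          (sym (encode≡sum H _ j)))
      ; φ-injective = λ x xd≡0 i → cancel-nonzeroʳ (x i) (d i) (d≢0 i) (xd≡0 i)
      ; span-preserved = λ l l′ (a , e) → a , λ i → begin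
          H′ i l′          ≡⟨ H′≡ i l′ ⟩
          d i * H i l′     ≡⟨ cong (d i *_) (e i) ⟩
          d i * (a * H i l) ≡⟨ trans (sym (*-assoc (d i) a _)) (trans (cong (_* H i l) (*-comm (d i) a)) (*-assoc a (d i) _)) ⟩
          a * (d i * H i l) ≡⟨ cong (a *_) (sym (H′≡ i l)) ⟩
          a * H′ i l       ∎ }
      where open ≡-Reasoning

    undo : ∀ i j → H i j ≡ inv (d i) (d≢0 i) * H′ i j
    undo i j = sym (begin
      inv (d i) _ * H′ i j      ≡⟨ cong (inv (d i) _ *_) (H′≡ i j) ⟩
      inv (d i) _ * (d i * H i j) ≡⟨ sym (*-assoc _ _ _) ⟩
      inv (d i) _ * d i * H i j  ≡⟨ cong (_* H i j) (inv-l (d i) (d≢0 i)) ⟩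
      1# * H i j                ≡⟨ *-identityˡ _ ⟩
      H i j                     ∎)
      where open ≡-Reasoning

  scale : ∀ {k n} (H H′ : Matrix F k n) (d : Fin k → Carrier) → (∀ i → d i ≢ 0#) →
    (∀ i j → H′ i j ≡ d i * H i j) → RowEquivalent H H′
  scale H H′ d d≢0 H′≡ = rowEquivalent A.operation B.operation
    where
    module A = Scale H H′ d d≢0 H′≡
    module B = Scale H′ H (λ i → inv (d i) (d≢0 i)) (λ i → inv-nz (d i) (d≢0 i)) A.undo

  samespan-scale : ∀ {k} {g v : Vector F k} t → t ≢ 0# → (∀ i → v i ≡ t * g i) → SameSpan F g v
  samespan-scale {g = g} {v} t t≢0 v≡tg = samespan⇐ (t , v≡tg) (inv t t≢0 , g≡t⁻¹v)
    where
    open ≡-Reasoning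
    g≡t⁻¹v : ∀ i → g i ≡ inv t t≢0 * v i
    g≡t⁻¹v i = begin
      g i                    ≡⟨ sym (*-identityˡ (g i)) ⟩
      1# * g i               ≡⟨ cong (_* g i) (sym (inv-l t t≢0)) ⟩
      inv t t≢0 * t * g i    ≡⟨ *-assoc _ t (g i) ⟩
      inv t t≢0 * (t * g i)  ≡⟨ cong (inv t t≢0 *_) (sym (v≡tg i)) ⟩
      inv t t≢0 * v i        ∎

  extend0 : ∀ {k} → Vector F k → Vector F (suc k)
  extend0 {zero} x i = 0#
  extend0 {suc k} x Fin.zero = x Fin.zero
  extend0 {suc k} x (Fin.suc i) = extend0 (x ∘ Fin.suc) i

  sum-extend0 : ∀ {k} (x : Vector F k) (g : Fin (suc k) → Carrier) →
    sum (λ i → extend0 x i * g i) ≡ sum (λ i → x i * g (Fin.inject₁ i))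
  sum-extend0 {zero} x g = trans (+-identityʳ _) (zeroˡ _)
  sum-extend0 {suc k} x g = cong (x Fin.zero * g Fin.zero +_) (sum-extend0 (x ∘ Fin.suc) (g ∘ Fin.suc))

  UnitColumn : ∀ {k n} → Matrix F k n → Fin n → Fin k → Set
  UnitColumn M l p = ∀ i → (i ≡ p → M i l ≡ 1#) × (i ≢ p → M i l ≡ 0#)

  pivot : ∀ {k n} (M : Matrix F k n) (p : Fin k) (l : Fin n) → M p l ≢ 0# →
    Σ (Matrix F k n) λ M′ → RowEquivalent M M′ × UnitColumn M′ l p ×
      (∀ j → M p j ≡ 0# → ∀ i → M′ i j ≡ M i j)
  pivot {k} {n} M p l Mpl≢0 = M₂ , rowEquivalent-trans M~M₁ M₁~M₂ , unit-l , untouched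
    where
    open ≡-Reasoning
    d : Fin k → Carrier
    d = updateAt (λ _ → 1#) p (λ _ → inv (M p l) Mpl≢0)
    d≢0 : ∀ i → d i ≢ 0#
    d≢0 i with i Fin.≟ p
    ... | yes refl = subst (_≢ 0#) (sym (updateAt-updates p (λ _ → 1#))) (inv-nz _ Mpl≢0)
    ... | no i≢p = subst (_≢ 0#) (sym (updateAt-minimal i p (λ _ → 1#) i≢p)) 1≢0
    M₁ : Matrix F k n
    M₁ i j = d i * M i j
    M~M₁ : RowEquivalent M M₁
    M~M₁ = scale M M₁ d d≢0 (λ i j → refl)
    c : Fin k → Carrier
    c = updateAt (λ i → - M₁ i l) p (λ _ → 0#)
    M₂ : Matrix F k n
    M₂ i j = M₁ i j + c i * M₁ p j
    M₁~M₂ : RowEquivalent M₁ M₂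
    M₁~M₂ = addMultiple M₁ M₂ p c (updateAt-updates p _) (λ i j → refl)
    M₁pl≡1 : M₁ p l ≡ 1#
    M₁pl≡1 = trans (cong (_* M p l) (updateAt-updates p (λ _ → 1#))) (inv-l _ Mpl≢0)
    unit-l : UnitColumn M₂ l p
    unit-l i = (λ { refl → begin
        M₁ p l + c p * M₁ p l ≡⟨ cong (λ t → M₁ p l + t * M₁ p l) (updateAt-updates p _) ⟩
        M₁ p l + 0# * M₁ p l  ≡⟨ cong (M₁ p l +_) (zeroˡ _) ⟩
        M₁ p l + 0#           ≡⟨ +-identityʳ _ ⟩
        M₁ p l                ≡⟨ M₁pl≡1 ⟩
        1#                    ∎ })
      , λ i≢p → begin
        M₁ i l + c i * M₁ p l  ≡⟨ cong₂ (λ u w → M₁ i l + u * w) (updateAt-minimal i p _ i≢p) M₁pl≡1 ⟩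
        M₁ i l + - M₁ i l * 1# ≡⟨ cong (M₁ i l +_) (*-identityʳ _) ⟩
        M₁ i l + - M₁ i l      ≡⟨ -‿inverseʳ _ ⟩
        0#                     ∎
    untouched : ∀ j → M p j ≡ 0# → ∀ i → M₂ i j ≡ M i j
    untouched j Mpj≡0 i with i Fin.≟ p
    ... | yes refl = begin
        M₁ p j + c p * M₁ p j ≡⟨ cong (λ t → t + c p * t) M₁pj≡0 ⟩
        0# + c p * 0#         ≡⟨ trans (+-identityˡ _) (zeroʳ _) ⟩
        0#                    ≡⟨ sym Mpj≡0 ⟩
        M p j                 ∎
      where
      M₁pj≡0 : M₁ p j ≡ 0#
      M₁pj≡0 = trans (cong (d p *_) Mpj≡0) (zeroʳ _)
    ... | no i≢p = begin
        M₁ i j + c i * M₁ p j     ≡⟨ cong (λ t → M₁ i j + c i * t) (trans (cong (d p *_) Mpj≡0) (zeroʳ _)) ⟩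
        M₁ i j + c i * 0#         ≡⟨ trans (cong (M₁ i j +_) (zeroʳ _)) (+-identityʳ _) ⟩
        d i * M i j               ≡⟨ cong (_* M i j) (updateAt-minimal i p _ i≢p) ⟩
        1# * M i j                ≡⟨ *-identityˡ _ ⟩
        M i j                     ∎

-- Gaussian elimination on G′ (with k + 1 rows) relative to the class of
-- column j₀.  The matrices handled have n + r columns, the last r of which
-- correspond to the class of j₀ in G′.
module Elimination (F : FiniteField) (k n r₀ n′ : ℕ) (G′ : Matrix F (suc k) n′)
                   (j₀ : Fin n′) where
  open Field F

  r N : ℕ
  r = suc r₀
  N = n ℕ.+ r

  Class : Fin n′ → Set
  Class d = SameSpan F (column F G′ d) (column F G′ j₀)

  kk : Fin (suc k)
  kk = Fin.fromℕ k

  l₀ : Fin N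
  l₀ = n ↑ʳ Fin.zero

  record Presentation (M : Matrix F (suc k) N) : Set where
    field
      σ : Fin N → Fin n′
      σ⁻¹ : Fin n′ → Fin N
      σσ⁻¹ : ∀ d → σ (σ⁻¹ d) ≡ d
      σ⁻¹σ : ∀ l → σ⁻¹ (σ l) ≡ l
      code⇒ : ∀ w → InCode F M w → InCode F G′ (w ∘ σ⁻¹)
      code⇐ : ∀ w → InCode F G′ (w ∘ σ⁻¹) → InCode F M w
      span⇒ : ∀ l l′ → InSpan F (column F M l) (column F M l′) → InSpan F (column F G′ (σ l)) (column F G′ (σ l′))
      span⇐ : ∀ l l′ → InSpan F (column F G′ (σ l)) (column F G′ (σ l′)) → InSpan F (column F M l) (column F M l′)
      fullRank : FullRank F M
      class-last : ∀ a → Class (σ (n ↑ʳ a))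
      nonclass-first : ∀ j → ¬ Class (σ (j ↑ˡ r))

  presentation-rowEquivalent : ∀ {M M′} → Presentation M → RowEquivalent M M′ → Presentation M′
  presentation-rowEquivalent P M~M′ = record
    { σ = σ ; σ⁻¹ = σ⁻¹ ; σσ⁻¹ = σσ⁻¹ ; σ⁻¹σ = σ⁻¹σ
    ; code⇒ = λ w → code⇒ w ∘ E.code⇐ w
    ; code⇐ = λ w → E.code⇒ w ∘ code⇐ w
    ; span⇒ = λ l l′ → span⇒ l l′ ∘ E.span⇐ l l′
    ; span⇐ = λ l l′ → E.span⇒ l l′ ∘ span⇐ l l′
    ; fullRank = E.fullRank⇒ fullRank ; class-last = class-last ; nonclass-first = nonclass-first }
    where
    open Presentation P
    module E = RowEquivalent M~M′

  initial-presentation : FullRank F G′ → (S : Split Class n r) → Presentation (λ i l → G′ i (Split.f S l))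
  initial-presentation fr′ S = record
    { σ = f ; σ⁻¹ = f⁻¹ ; σσ⁻¹ = ff⁻¹ ; σ⁻¹σ = f⁻¹f
    ; code⇒ = permute-code⇒ G′ f f⁻¹ ff⁻¹
    ; code⇐ = permute-code⇐ G′ f f⁻¹ f⁻¹f
    ; span⇒ = λ l l′ s → s ; span⇐ = λ l l′ s → s
    ; fullRank = permute-fullRank G′ f f⁻¹ ff⁻¹ fr′
    ; class-last = inside ; nonclass-first = outside }
    where open Split S

  swapColumns : Matrix F (suc k) N → (q c : Fin n) → Matrix F (suc k) N
  swapColumns M q c i l = M i (PC.transpose (q ↑ˡ r) (c ↑ˡ r) l)

  swap-fixes-class : ∀ (q c : Fin n) a → PC.transpose (q ↑ˡ r) (c ↑ˡ r) (n ↑ʳ a) ≡ n ↑ʳ a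
  swap-fixes-class q c a = transpose-fixes (↑ˡ≢↑ʳ q a ∘ sym) (↑ˡ≢↑ʳ c a ∘ sym)

  presentation-swap : ∀ {M} → Presentation M → (q c : Fin n) → Presentation (swapColumns M q c)
  presentation-swap {M} P q c = record
    { σ = σ ∘ τ ; σ⁻¹ = τ′ ∘ σ⁻¹
    ; σσ⁻¹ = λ d → trans (cong σ (PC.transpose-inverse x y)) (σσ⁻¹ d)
    ; σ⁻¹σ = λ l → trans (cong τ′ (σ⁻¹σ (τ l))) (PC.transpose-inverse y x)
    ; code⇒ = λ w → code⇒ (w ∘ τ′) ∘ permute-code⇒ M τ τ′ (λ _ → PC.transpose-inverse x y) w
    ; code⇐ = λ w → permute-code⇐ M τ τ′ (λ _ → PC.transpose-inverse y x) w ∘ code⇐ (w ∘ τ′)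
    ; span⇒ = λ l l′ → span⇒ (τ l) (τ l′)
    ; span⇐ = λ l l′ → span⇐ (τ l) (τ l′)
    ; fullRank = permute-fullRank M τ τ′ (λ _ → PC.transpose-inverse x y) fullRank
    ; class-last = λ a → subst Class (cong σ (sym (swap-fixes-class q c a))) (class-last a)
    ; nonclass-first = nonclass-first′ }
    where
    open Presentation P
    x y : Fin N
    x = q ↑ˡ r
    y = c ↑ˡ r
    τ τ′ : Fin N → Fin N
    τ = PC.transpose x y
    τ′ = PC.transpose y x
    nonclass-first′ : ∀ j → ¬ Class (σ (τ (j ↑ˡ r)))
    nonclass-first′ j with transpose-cases x y (j ↑ˡ r)
    ... | inj₁ e = subst (λ t → ¬ Class (σ t)) (sym e) (nonclass-first c)
    ... | inj₂ (inj₁ e) = subst (λ t → ¬ Class (σ t)) (sym e) (nonclass-first q)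
    ... | inj₂ (inj₂ e) = subst (λ t → ¬ Class (σ t)) (sym e) (nonclass-first j)

  presentation-effectiveLength : ∀ {M} → EffectiveLength F G′ → Presentation M → EffectiveLength F M
  presentation-effectiveLength el′ P l with el′ (Presentation.σ P l)
  ... | v′ , v′∈C′ , v′≢0 =
    v′ ∘ σ , code⇐ _ (InCode-cong G′ v′∈C′ (λ d → cong v′ (sym (σσ⁻¹ d)))) , v′≢0
    where open Presentation P

  IdentityEntry : Matrix F (suc k) N → Fin (suc k) → Fin n → Set
  IdentityEntry M i j = (toℕ i ≡ toℕ j → M i (j ↑ˡ r) ≡ 1#) × (toℕ i ≢ toℕ j → M i (j ↑ˡ r) ≡ 0#)

  record Reduced (p : ℕ) (M : Matrix F (suc k) N) : Set where
    field
      presentation : Presentation M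
      last-pivot : M kk l₀ ≡ 1#
      class-zero : ∀ a i → i ≢ kk → M i (n ↑ʳ a) ≡ 0#
      unit-prefix : ∀ (j : Fin n) i → toℕ j < p → IdentityEntry M i j
      p≤n : p ≤ n

  last-entry-nonzero : ∀ {M} → EffectiveLength F G′ → Presentation M →
    Σ (Matrix F (suc k) N) λ M′ → Presentation M′ × M′ kk l₀ ≢ 0#
  last-entry-nonzero {M} el′ P with M kk l₀ ≟ 0#
  ... | no Mkl≢0 = M , P , Mkl≢0
  ... | yes Mkl≡0 with effectiveLength⇒nonzeroColumns M (presentation-effectiveLength el′ P) l₀
  ... | q , Mql≢0 = M′ , presentation-rowEquivalent P M~M′ , M′kl≢0
    where
    q≢kk : q ≢ kk
    q≢kk q≡kk = Mql≢0 (trans (cong (λ t → M t l₀) q≡kk) Mkl≡0)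
    M′ : Matrix F (suc k) N
    M′ i j = M i j + single kk 1# i * M q j
    M~M′ : RowEquivalent M M′
    M~M′ = addMultiple M M′ q (single kk 1#) (single-off 1# q≢kk) (λ i j → refl)
    M′kl≢0 : M′ kk l₀ ≢ 0#
    M′kl≢0 e = Mql≢0 (trans (sym (trans (cong₂ (λ u w → u + w * M q l₀) Mkl≡0 (single-at kk 1#))
                                    (trans (+-identityˡ _) (*-identityˡ _)))) e)

  -- Pivoting at (kk, l₀) makes column l₀ equal to e_k; the other class
  -- columns are proportional to it, so they vanish off the last row.
  reduce-class : ∀ {M} → EffectiveLength F G′ → Presentation M → Σ (Matrix F (suc k) N) (Reduced 0)
  reduce-class el′ P with last-entry-nonzero el′ P
  ... | M′ , P′ , M′kl≢0 with pivot M′ kk l₀ M′kl≢0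
  ... | M″ , M′~M″ , unit-l₀ , _ = M″ , record
    { presentation = P″ ; last-pivot = proj₁ (unit-l₀ kk) refl ; class-zero = class-zero
    ; unit-prefix = λ j i () ; p≤n = z≤n }
    where
    P″ = presentation-rowEquivalent P′ M′~M″
    open Presentation P″
    class-zero : ∀ a i → i ≢ kk → M″ i (n ↑ʳ a) ≡ 0#
    class-zero a i i≢kk with span⇐ l₀ (n ↑ʳ a) (proj₁ (samespan⇒ (samespan-trans (class-last Fin.zero) (samespan-sym (class-last a)))))
    ... | t , e = trans (e i) (trans (cong (t *_) (proj₂ (unit-l₀ i) i≢kk)) (zeroʳ t))

  row : ∀ {p} → p < k → Fin (suc k)
  row p<k = Fin.fromℕ< (NP.m<n⇒m<1+n p<k)

  toℕ-row : ∀ {p} (p<k : p < k) → toℕ (row p<k) ≡ p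
  toℕ-row p<k = FinP.toℕ-fromℕ< (NP.m<n⇒m<1+n p<k)

  row≢kk : ∀ {p} (p<k : p < k) → row p<k ≢ kk
  row≢kk p<k e = NP.<⇒≢ p<k (trans (sym (toℕ-row p<k)) (trans (cong toℕ e) (FinP.toℕ-fromℕ k)))

  -- In a matrix reduced up to p < k, row p has a non-zero entry in some
  -- non-class column c ≥ p: otherwise the whole row would vanish (class
  -- columns vanish off the last row, and the first p non-class columns are
  -- unit vectors of other rows), contradicting full rank.
  pivot-exists : ∀ {p M} (p<k : p < k) → Reduced p M → ∃[ c ] (p ≤ toℕ c × M (row p<k) (c ↑ˡ r) ≢ 0#)
  pivot-exists {p} {M} p<k R with FinP.any? (λ c → (p NP.≤? toℕ c) ×-dec ¬? (M (row p<k) (c ↑ˡ r) ≟ 0#))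
  ... | yes found = found
  ... | no none = ⊥-elim (1≢0 (trans (sym (single-at i 1#)) (fullRank (single i 1#) row-codeword-zero i)))
    where
    open Reduced R
    open Presentation presentation
    i = row p<k
    row-zero : ∀ l → M i l ≡ 0#
    row-zero l with ↑-view n l
    ... | inj₂ (a , refl) = class-zero a i (row≢kk p<k)
    ... | inj₁ (j , refl) with toℕ j NP.<? p
    ... | yes j<p = proj₂ (unit-prefix j i j<p) (λ e → NP.<⇒≢ j<p (trans (sym e) (toℕ-row p<k)))
    ... | no j≮p with M i (j ↑ˡ r) ≟ 0#
    ... | yes Mij≡0 = Mij≡0
    ... | no Mij≢0 = ⊥-elim (none (j , NP.≮⇒≥ j≮p , Mij≢0))
    row-codeword-zero : IsZero F (encode F M (single i 1#))
    row-codeword-zero l =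
      trans (encode≡sum M (single i 1#) l) (trans (sum-single i 1# (λ t → M t l)) (trans (cong (1# *_) (row-zero l)) (zeroʳ _)))

  reduced-swap : ∀ {p M} (q c : Fin n) → p ≤ toℕ q → p ≤ toℕ c → Reduced p M → Reduced p (swapColumns M q c)
  reduced-swap {p} {M} q c p≤q p≤c R = record
    { presentation = presentation-swap presentation q c
    ; last-pivot = trans (cong (M kk) (swap-fixes-class q c Fin.zero)) last-pivot
    ; class-zero = λ a i i≢kk → trans (cong (M i) (swap-fixes-class q c a)) (class-zero a i i≢kk)
    ; unit-prefix = λ j i j<p →
        subst (λ t → (toℕ i ≡ toℕ j → M i t ≡ 1#) × (toℕ i ≢ toℕ j → M i t ≡ 0#))
              (sym (fixes-prefix j j<p)) (unit-prefix j i j<p)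
    ; p≤n = p≤n }
    where
    open Reduced R
    fixes-prefix : ∀ j → toℕ j < p → PC.transpose (q ↑ˡ r) (c ↑ˡ r) (j ↑ˡ r) ≡ j ↑ˡ r
    fixes-prefix j j<p = transpose-fixes (beyond q p≤q) (beyond c p≤c)
      where
      beyond : ∀ t → p ≤ toℕ t → j ↑ˡ r ≢ t ↑ˡ r
      beyond t p≤t e = NP.<⇒≱ j<p (subst (p ≤_) (cong toℕ (sym (FinP.↑ˡ-injective r j t e))) p≤t)

  -- Pivoting at row p and non-class column q = p extends the reduction to
  -- p + 1: the earlier unit columns and the class columns vanish in row p,
  -- so the pivot leaves them unchanged.
  reduced-pivot : ∀ {p M} (p<k : p < k) (q : Fin n) → toℕ q ≡ p → M (row p<k) (q ↑ˡ r) ≢ 0# → Reduced p M →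
    Σ (Matrix F (suc k) N) (Reduced (suc p))
  reduced-pivot {p} {M} p<k q q≡p Mpq≢0 R with pivot M (row p<k) (q ↑ˡ r) Mpq≢0
  ... | M′ , M~M′ , unit-q , untouched = M′ , record
    { presentation = presentation-rowEquivalent presentation M~M′
    ; last-pivot = trans (class-untouched Fin.zero kk) last-pivot
    ; class-zero = λ a i′ i′≢kk → trans (class-untouched a i′) (class-zero a i′ i′≢kk)
    ; unit-prefix = unit-prefix′
    ; p≤n = subst (_< n) q≡p (FinP.toℕ<n q) }
    where
    open Reduced R
    i = row p<k
    class-untouched : ∀ a i′ → M′ i′ (n ↑ʳ a) ≡ M i′ (n ↑ʳ a)
    class-untouched a = untouched (n ↑ʳ a) (class-zero a i (row≢kk p<k))
    unit-at-q : ∀ i′ → IdentityEntry M′ i′ q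
    unit-at-q i′ =
        (λ e → proj₁ (unit-q i′) (FinP.toℕ-injective (trans e (trans q≡p (sym (toℕ-row p<k))))))
      , (λ ne → proj₂ (unit-q i′) (λ e → ne (trans (cong toℕ e) (trans (toℕ-row p<k) (sym q≡p)))))
    unit-prefix′ : ∀ (j : Fin n) i′ → toℕ j < suc p → IdentityEntry M′ i′ j
    unit-prefix′ j i′ j<1+p with toℕ j NP.<? p
    ... | yes j<p = (λ e → trans same (proj₁ (unit-prefix j i′ j<p) e))
                  , (λ ne → trans same (proj₂ (unit-prefix j i′ j<p) ne))
      where
      same : M′ i′ (j ↑ˡ r) ≡ M i′ (j ↑ˡ r)
      same = untouched (j ↑ˡ r) (proj₂ (unit-prefix j i j<p) (λ e → NP.<⇒≢ j<p (trans (sym e) (toℕ-row p<k)))) i′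
    ... | no j≮p = subst (IdentityEntry M′ i′) (sym j≡q) (unit-at-q i′)
      where
      j≡q : j ≡ q
      j≡q = FinP.toℕ-injective (trans (NP.≤-antisym (ℕ.s≤s⁻¹ j<1+p) (NP.≮⇒≥ j≮p)) (sym q≡p))

  step : ∀ {p M} → p < k → Reduced p M → Σ (Matrix F (suc k) N) (Reduced (suc p))
  step {p} {M} p<k R with pivot-exists p<k R
  ... | c , p≤c , Mpc≢0 =
    reduced-pivot p<k q q≡p Mpq≢0 (reduced-swap q c (NP.≤-reflexive (sym q≡p)) p≤c R)
    where
    p<n : p < n
    p<n = NP.≤-<-trans p≤c (FinP.toℕ<n c)
    q : Fin n
    q = Fin.fromℕ< p<n
    q≡p : toℕ q ≡ p
    q≡p = FinP.toℕ-fromℕ< p<n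
    Mpq≢0 : swapColumns M q c (row p<k) (q ↑ˡ r) ≢ 0#
    Mpq≢0 e = Mpc≢0 (trans (cong (M (row p<k)) (sym (transpose-moves (q ↑ˡ r) (c ↑ˡ r)))) e)

  reduce-from : ∀ t p → t ℕ.+ p ≡ k → ∀ {M} → Reduced p M → Σ (Matrix F (suc k) N) (Reduced k)
  reduce-from zero p t+p≡k {M} R = M , subst (λ q → Reduced q M) t+p≡k R
  reduce-from (suc t) p t+p≡k R = reduce-from t (suc p) (trans (NP.+-suc t p) t+p≡k) (proj₂ (step p<k R))
    where
    p<k : p < k
    p<k = subst (p <_) t+p≡k (s≤s (NP.m≤n+m p t))

  reduce : ∀ {M} → EffectiveLength F G′ → Presentation M → Σ (Matrix F (suc k) N) (Reduced k)
  reduce el′ P = reduce-from k 0 (NP.+-identityʳ k) (proj₂ (reduce-class el′ P))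

  module Extraction (W : ℕ → Set) (el′ : EffectiveLength F G′) (wts′ : WeightsIn F W G′)
                    (mm′ : MinMultAtLeast F G′ r) (M₂ : Matrix F (suc k) N) (R : Reduced k M₂) where
    open Reduced R
    open Presentation presentation
    open BlockSwap k n r₀ p≤n using (ψ; θ; ψθ; θψ; ψ-lo; ψ-k; θ-increasing)

    G : Matrix F k n
    G i j = M₂ (Fin.inject₁ i) (j ↑ˡ r)

    G″ : Matrix F (suc k) N
    G″ i l = M₂ i (ψ l)

    ι : Fin n → Fin N
    ι j = θ (j ↑ˡ r)

    inject₁≢kk : ∀ (i : Fin k) → Fin.inject₁ i ≢ kk
    inject₁≢kk i = FinP.fromℕ≢inject₁ ∘ sym

    π : Fin n′ → Fin N
    π = θ ∘ σ⁻¹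

    π⁻¹ : Fin N → Fin n′
    π⁻¹ = σ ∘ ψ

    ππ⁻¹ : ∀ l → π (π⁻¹ l) ≡ l
    ππ⁻¹ l = trans (cong θ (σ⁻¹σ (ψ l))) (θψ l)

    π⁻¹π : ∀ d → π⁻¹ (π d) ≡ d
    π⁻¹π d = trans (cong σ (ψθ (σ⁻¹ d))) (σσ⁻¹ d)

    code-G″⇒ : ∀ v → InCode F G″ v → InCode F G′ (v ∘ π)
    code-G″⇒ v = code⇒ (v ∘ θ) ∘ permute-code⇒ M₂ ψ θ ψθ v

    code-G″⇐ : ∀ v → InCode F G′ (v ∘ π) → InCode F G″ v
    code-G″⇐ v = permute-code⇐ M₂ ψ θ θψ v ∘ code⇐ (v ∘ θ)

    G-systematic : Systematic F G
    G-systematic = p≤n , λ i j j<k →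
        (λ e → proj₁ (unit-prefix j (Fin.inject₁ i) j<k) (trans (FinP.toℕ-inject₁ i) e))
      , (λ ne → proj₂ (unit-prefix j (Fin.inject₁ i) j<k) (ne ∘ trans (sym (FinP.toℕ-inject₁ i))))

    -- The first k columns of G″ are those of G; column k is l₀ = e_k.
    G″-systematic : Systematic F G″
    G″-systematic = subst (_≤ N) (NP.+-comm k 1) (NP.+-mono-≤ p≤n (s≤s z≤n)) , entry
      where
      entry : ∀ (i : Fin (suc k)) (l : Fin N) → toℕ l < suc k →
              (toℕ i ≡ toℕ l → G″ i l ≡ 1#) × (toℕ i ≢ toℕ l → G″ i l ≡ 0#)
      entry i l l<1+k = by-position (toℕ l NP.<? k)
        where
        Goal : Set
        Goal = (toℕ i ≡ toℕ l → G″ i l ≡ 1#) × (toℕ i ≢ toℕ l → G″ i l ≡ 0#)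
        below-k : toℕ l < k → Σ (Fin n) (λ j → ψ l ≡ j ↑ˡ r × toℕ j ≡ toℕ l) → Goal
        below-k l<k (j , ψl≡j , j≡l) =
            (λ e → trans (cong (M₂ i) ψl≡j) (proj₁ (unit-prefix j i j<k) (trans e (sym j≡l))))
          , (λ ne → trans (cong (M₂ i) ψl≡j) (proj₂ (unit-prefix j i j<k) (ne ∘ flip trans j≡l)))
          where
          j<k : toℕ j < k
          j<k = subst (_< k) (sym j≡l) l<k
        by-position : Dec (toℕ l < k) → Goal
        by-position (yes l<k) = below-k l<k (ψ-lo l l<k)
        by-position (no l≮k) =
            (λ e → trans (cong (M₂ i) (ψ-k l l≡k)) (subst (λ t → M₂ t l₀ ≡ 1#) (sym (i≡kk e)) last-pivot))
          , (λ ne → trans (cong (M₂ i) (ψ-k l l≡k))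
                          (class-zero Fin.zero i (λ e → ne (trans (cong toℕ e) (trans (FinP.toℕ-fromℕ k) (sym l≡k))))))
          where
          l≡k : toℕ l ≡ k
          l≡k = NP.≤-antisym (ℕ.s≤s⁻¹ l<1+k) (NP.≮⇒≥ l≮k)
          i≡kk : toℕ i ≡ toℕ l → i ≡ kk
          i≡kk e = FinP.toℕ-injective (trans e (trans l≡k (sym (FinP.toℕ-fromℕ k))))

    G″-generates : GeneratesCode F (suc k) N W G″
    G″-generates = systematic⇒fullRank G″ G″-systematic
                 , nonzeroColumns⇒effectiveLength G″
                     (λ l → effectiveLength⇒nonzeroColumns M₂ (presentation-effectiveLength el′ presentation) (ψ l))
                 , weights
      where
      weights : WeightsIn F W G″
      weights v v∈C″ v≢0 = subst W (wt-permute π π⁻¹ ππ⁻¹ π⁻¹π v)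
        (wts′ _ (code-G″⇒ v v∈C″) (λ vπ≡0 → v≢0 (λ l → trans (cong v (sym (ππ⁻¹ l))) (vπ≡0 (π⁻¹ l)))))

    G″≅G′ : Isomorphic F G″ G′
    G″≅G′ = mk↔ₛ′ π π⁻¹ ππ⁻¹ π⁻¹π
          , (λ _ → 1#) , mk↔ₛ′ (λ x → x) (λ x → x) (λ _ → refl) (λ _ → refl)
          , (λ _ → 1≢0) , (λ _ _ → refl) , (λ _ _ → refl)
          , λ v → (λ v∈C″ → InCode-cong G′ (code-G″⇒ v v∈C″) (λ d → sym (*-identityˡ _)))
                , (λ v∈C′ → code-G″⇐ v (InCode-cong G′ v∈C′ (λ d → *-identityˡ _)))

    G″-extends-G : FirstRowsInserted F r G G″
    G″-extends-G = ι , θ-increasing , (λ i j → cong (M₂ (Fin.inject₁ i)) (ψθ (j ↑ˡ r))) , zero-elsewhere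
      where
      zero-elsewhere : ∀ (i : Fin k) (l : Fin N) → (∀ j → ι j ≢ l) → G″ (Fin.inject₁ i) l ≡ 0#
      zero-elsewhere i l l∉ι with ↑-view n (ψ l)
      ... | inj₁ (j , ψl≡j) = ⊥-elim (l∉ι j (trans (cong θ (sym ψl≡j)) (θψ l)))
      ... | inj₂ (a , ψl≡a) = trans (cong (M₂ (Fin.inject₁ i)) ψl≡a) (class-zero a (Fin.inject₁ i) (inject₁≢kk i))

    -- A non-class column of M₂ vanishing in the first k rows would be a
    -- non-zero multiple of l₀ = e_k, hence in the class of j₀; so no column
    -- of G is zero.
    G-nonzeroColumns : ∀ j → ∃[ i ] (G i j ≢ 0#)
    G-nonzeroColumns j with FinP.any? (λ i → ¬? (G i j ≟ 0#))
    ... | yes found = found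
    ... | no none = ⊥-elim (nonclass-first j (samespan-trans (samespan-sym l₀~l) (class-last Fin.zero)))
      where
      l : Fin N
      l = j ↑ˡ r
      top-zero : ∀ i → M₂ (Fin.inject₁ i) l ≡ 0#
      top-zero i with G i j ≟ 0#
      ... | yes Gij≡0 = Gij≡0
      ... | no Gij≢0 = ⊥-elim (none (i , Gij≢0))
      t : Carrier
      t = M₂ kk l
      t≢0 : t ≢ 0#
      t≢0 with effectiveLength⇒nonzeroColumns M₂ (presentation-effectiveLength el′ presentation) l
      ... | i , Mil≢0 with last-view k i
      ...   | inj₁ i≡kk = subst (λ i′ → M₂ i′ l ≢ 0#) i≡kk Mil≢0
      ...   | inj₂ (i′ , i≡i′) = ⊥-elim (Mil≢0 (trans (cong (λ i″ → M₂ i″ l) i≡i′) (top-zero i′)))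
      multiple : ∀ i → M₂ i l ≡ t * M₂ i l₀
      multiple i with last-view k i
      ... | inj₁ refl = trans (sym (*-identityʳ t)) (cong (t *_) (sym last-pivot))
      ... | inj₂ (i′ , refl) = trans (top-zero i′) (sym (trans (cong (t *_) (class-zero _ _ (inject₁≢kk i′))) (zeroʳ t)))
      l₀~l : SameSpan F (column F G′ (σ l₀)) (column F G′ (σ l))
      l₀~l = samespan⇐ (span⇒ l₀ l (proj₁ (samespan⇒ M₂-l₀~l))) (span⇒ l l₀ (proj₂ (samespan⇒ M₂-l₀~l)))
        where
        M₂-l₀~l = samespan-scale t t≢0 multiple

    -- Codewords of G are codewords of G″ (message extended by 0) restricted
    -- to the coordinates ι; the remaining r coordinates vanish, so weights
    -- are preserved.
    G-weights : WeightsIn F W G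
    G-weights v (x , xG≡v) v≢0 = subst W wt-u≡wt-v (proj₂ (proj₂ G″-generates) u (extend0 x , λ _ → refl) u≢0)
      where
      u : Vector F N
      u = encode F G″ (extend0 x)
      u-top : ∀ l → u l ≡ sum (λ i → x i * G″ (Fin.inject₁ i) l)
      u-top l = trans (encode≡sum G″ (extend0 x) l) (sum-extend0 x (λ i → G″ i l))
      u∘ι : ∀ j → u (ι j) ≡ v j
      u∘ι j = trans (u-top (ι j)) (trans (sum-cong-≗ (λ i → cong (λ t → x i * M₂ (Fin.inject₁ i) t) (ψθ (j ↑ˡ r))))
                                   (trans (sym (encode≡sum G x j)) (xG≡v j)))
      u-class : ∀ a → u (θ (n ↑ʳ a)) ≡ 0#
      u-class a = trans (u-top _) (sum-zero (λ i →
        trans (cong (λ t → x i * M₂ (Fin.inject₁ i) t) (ψθ (n ↑ʳ a)))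
              (trans (cong (x i *_) (class-zero a _ (inject₁≢kk i))) (zeroʳ _))))
      u≢0 : ¬ IsZero F u
      u≢0 u≡0 = v≢0 (λ j → trans (sym (u∘ι j)) (u≡0 (ι j)))
      wt-u≡wt-v : wt F u ≡ wt F v
      wt-u≡wt-v = begin
        wt F u                                       ≡⟨ sym (wt-permute θ ψ θψ ψθ u) ⟩
        wt F (u ∘ θ)                                 ≡⟨ wt-split n (u ∘ θ) ⟩
        wt F (u ∘ ι) ℕ.+ wt F (λ a → u (θ (n ↑ʳ a))) ≡⟨ cong₂ ℕ._+_ (wt-cong u∘ι) (wt-zero _ u-class) ⟩
        wt F v ℕ.+ 0                                 ≡⟨ NP.+-identityʳ _ ⟩
        wt F v                                       ∎
        where open ≡-Reasoning

    G-generates : GeneratesCode F k n W G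
    G-generates = systematic⇒fullRank G G-systematic , nonzeroColumns⇒effectiveLength G G-nonzeroColumns , G-weights

    samespan-G : ∀ j₁ j₂ → SameSpan F (column F G′ (σ (j₁ ↑ˡ r))) (column F G′ (σ (j₂ ↑ˡ r))) →
      SameSpan F (column F G j₁) (column F G j₂)
    samespan-G j₁ j₂ s = samespan⇐ (top-rows (span⇐ _ _ (proj₁ (samespan⇒ s)))) (top-rows (span⇐ _ _ (proj₂ (samespan⇒ s))))
      where
      top-rows : ∀ {l₁ l₂ : Fin n} → InSpan F (column F M₂ (l₁ ↑ˡ r)) (column F M₂ (l₂ ↑ˡ r)) →
        InSpan F (column F G l₁) (column F G l₂)
      top-rows (t , e) = t , e ∘ Fin.inject₁

    -- The class of column j in G contains (an injective image of) the class
    -- of σ (j ↑ˡ r) in G′, which has at least r members.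
    G-minMult : MinMultAtLeast F G r
    G-minMult j with enumerate (λ j′ → SameSpan F (column F G j′) (column F G j)) (λ j′ → samespan? _ _)
    ... | m , e , e-enum@(_ , _ , e-complete) with mm′ (σ (j ↑ˡ r))
    ...   | mc , (ec , ec-injective , ec-sound , _) , r≤mc = m , (e , e-enum) , NP.≤-trans r≤mc (FinP.injective⇒≤ g-injective)
      where
      c : Fin n′
      c = σ (j ↑ˡ r)
      behind : ∀ d → SameSpan F (column F G′ d) (column F G′ c) → ∃[ j′ ] (σ (j′ ↑ˡ r) ≡ d)
      behind d d~c with ↑-view n (σ⁻¹ d)
      ... | inj₁ (j′ , e′) = j′ , trans (cong σ (sym e′)) (σσ⁻¹ d)
      ... | inj₂ (b , e′) = ⊥-elim (nonclass-first j (samespan-trans (samespan-sym d~c)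
                              (subst Class (trans (cong σ (sym e′)) (σσ⁻¹ d)) (class-last b))))
      position : ∀ a → Σ (Fin m) λ b → σ (e b ↑ˡ r) ≡ ec a
      position a with behind (ec a) (ec-sound a)
      ... | j′ , σj′≡eca with e-complete j′ (samespan-G j′ j (subst (λ d → SameSpan F (column F G′ d) (column F G′ c)) (sym σj′≡eca) (ec-sound a)))
      ...   | b , eb≡j′ = b , trans (cong (λ t → σ (t ↑ˡ r)) eb≡j′) σj′≡eca
      g : Fin mc → Fin m
      g = proj₁ ∘ position
      g-injective : Injective _≡_ _≡_ g
      g-injective {a} {a′} ga≡ga′ = ec-injective (trans (sym (proj₂ (position a)))
        (trans (cong (λ b → σ (e b ↑ˡ r)) ga≡ga′) (proj₂ (position a′))))

extension : (F : FiniteField) (W : ℕ → Set) (k r₀ n′ : ℕ) (G′ : Matrix F (suc k) n′) →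
  GeneratesCode F (suc k) n′ W G′ → MinMult F G′ (suc r₀) →
  Σ (Matrix F k (n′ ∸ suc r₀)) λ G →
    Systematic F G × GeneratesCode F k (n′ ∸ suc r₀) W G × MinMultAtLeast F G (suc r₀) ×
    Σ (Matrix F (suc k) ((n′ ∸ suc r₀) ℕ.+ suc r₀)) λ G″ →
      InExtension F W (suc r₀) G G″ × Isomorphic F G″ G′
extension F W k r₀ n′ G′ (fr′ , el′ , wts′) (mm′ , j₀ , e₀ , e₀-enumerates) =
  G , G-systematic , G-generates , G-minMult , G″ , (G″-systematic , G″-generates , G″-extends-G) , G″≅G′
  where
  open Field F using (samespan?)
  open Elimination F k (n′ ∸ suc r₀) r₀ n′ G′ j₀
  reduced : Σ (Matrix F (suc k) N) (Reduced k)
  reduced = reduce el′ (initial-presentation fr′ (split Class (λ d → samespan? _ _) e₀ e₀-enumerates))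
  open Extraction W el′ wts′ mm′ (proj₁ reduced) (proj₂ reduced)

corollary2p3 : (F : FiniteField) (W : ℕ → Set) (n′ k′ r : ℕ)
    (G′ : Matrix F k′ n′) →
    GeneratesCode F k′ n′ W G′ →
    MinMult F G′ r →
    Σ (Matrix F (k′ ∸ 1) (n′ ∸ r)) λ G →
      Systematic F G × GeneratesCode F (k′ ∸ 1) (n′ ∸ r) W G × MinMultAtLeast F G r ×
      Σ (Matrix F (suc (k′ ∸ 1)) ((n′ ∸ r) ℕ.+ r)) λ G″ →
        InExtension F W r G G″ × Isomorphic F G″ G′
-- With no rows every codeword is zero, contradicting effective length.
corollary2p3 F W n′ zero r G′ (_ , el′ , _) (_ , j₀ , _) with el′ j₀
... | v , (x , xG′≡v) , vj₀≢0 = ⊥-elim (vj₀≢0 (sym (xG′≡v j₀)))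
-- Multiplicity 0 is impossible: every column lies in its own class.
corollary2p3 F W n′ (suc k) zero G′ _ (_ , j₀ , _ , _ , _ , complete) =
  ⊥-elim (FinP.¬Fin0 (proj₁ (complete j₀ (samespan⇐ (inspan-refl _) (inspan-refl _)))))
  where open Field F using (samespan⇐; inspan-refl)
corollary2p3 F W n′ (suc k) (suc r₀) G′ = extension F W k r₀ n′ G′
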